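{- Let $\ell\ge 3$ be an odd integer, let $G$ be an $\ell$-odd-connected graph, let $v$ be a vertex of $G$ and let $v_1,\ldots,v_k$ ($k\ge 2$) be some neighbors of $v$. If for every $i=1,\ldots,k-1$ the graph $G.v_ivv_{i+1}$ contains an edge-cut of odd size smaller than $\ell$, then the vertex set $V(G)$ can be partitioned into two sets $V_1$ and $V_2$ such that $v\in V_1$, $v_i\in V_2$ for all $i=1,\ldots,k$, and the edge-cut $E(V_1,V_2)$ has size exactly $\ell$.
   Context: Graphs may have loops and parallel edges. For a partition $(A,B)$ of the vertex set, the edge-cut $E(A,B)$ is the set of edges with one end in $A$ and the other in $B$. A graph is $k$-odd-connected if it has no edge-cut of odd size less than $k$. Splitting: for a vertex $v$ and neighbors $v_1,v_2$ of $v$, the graph $G.v_1vv_2$ is obtained by removing the edges $vv_1$ and $vv_2$ and adding a new vertex joined by one edge to $v_1$ and one edge to $v_2$ (a two-edge path between $v_1$ and $v_2$). If $vv_1$ is a loop ($v_1=v\ne v_2$), $G.v_1vv_2$ is obtained by removing the loop and subdividing $vv_2$ (symmetrically if $vv_2$ is a loop); if both are loops, the two loops are removed and a new vertex joined to $v$ by two parallel edges is added. -}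

module Defs where

open import Data.Nat using (ℕ; suc; _≤_; _<_; _%_)
open import Data.Fin using (Fin; inject₁; fromℕ; _≟_)
open import Data.List using (map; allFin)
open import Data.Nat.ListAction using (sum)
open import Data.Bool using (Bool; true; false; if_then_else_; _xor_)
open import Data.Product using (_×_; _,_; proj₁; proj₂)
open import Relation.Nullary using (¬_; yes; no)
open import Relation.Binary.PropositionalEquality using (_≡_)

-- A finite multigraph (loops and parallel edges allowed):
-- vertices Fin n, edges Fin m, each edge has an (unordered, recorded as a pair) pair of ends.
record Graph : Set where
  constructor graph
  field
    nV   : ℕ
    nE   : ℕ
    ends : Fin nE → Fin nV × Fin nV
open Graph public

-- A vertex set partition (A , B) is given by its indicator S : A = S⁻¹(true), B = S⁻¹(false).
-- Size of the edge-cut E(A,B): number of edges with one end in A and the other in B.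
cutSize : (G : Graph) → (Fin (nV G) → Bool) → ℕ
cutSize G S = sum (map crossing (allFin (nE G)))
  where
  crossing : Fin (nE G) → ℕ
  crossing e = if S (proj₁ (ends G e)) xor S (proj₂ (ends G e)) then 1 else 0

Odd : ℕ → Set
Odd n = n % 2 ≡ 1

HasSmallOddCut : ℕ → Graph → Set
HasSmallOddCut k G = Data.Product.Σ (Fin (nV G) → Bool) λ S → Odd (cutSize G S) × cutSize G S < k

OddConnected : ℕ → Graph → Set
OddConnected k G = ¬ HasSmallOddCut k G

Joins : (G : Graph) → Fin (nE G) → Fin (nV G) → Fin (nV G) → Set
Joins G e v u = (ends G e ≡ (v , u)) Data.Sum.⊎ (ends G e ≡ (u , v))
  where import Data.Sum

-- Splitting G.v₁vv₂ along distinct edges e₁ (joining v,v₁) and e₂ (joining v,v₂):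
-- the edges e₁,e₂ are removed and a new vertex (the last one) joined by one edge to v₁
-- and one edge to v₂ is added.  (We reuse the names e₁, e₂ for the two new edges.)
-- This uniform rule also yields exactly the loop cases of the definition:
-- if e₁ is a loop (v₁ = v) the loop is removed and vv₂ subdivided; if both are loops,
-- they are removed and a new vertex joined to v by two parallel edges is added.
split : (G : Graph) → (v : Fin (nV G)) → (e₁ : Fin (nE G)) → (v₁ : Fin (nV G))
      → (e₂ : Fin (nE G)) → (v₂ : Fin (nV G)) → Graph
split G v e₁ v₁ e₂ v₂ = graph (suc (nV G)) (nE G) ends′
  where
  new : Fin (suc (nV G))
  new = fromℕ (nV G)
  ends′ : Fin (nE G) → Fin (suc (nV G)) × Fin (suc (nV G))
  ends′ e with e ≟ e₁
  ... | yes _ = inject₁ v₁ , new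
  ... | no _ with e ≟ e₂
  ...   | yes _ = inject₁ v₂ , new
  ...   | no _  = inject₁ (proj₁ (ends G e)) , inject₁ (proj₂ (ends G e))

module Submission where

-- Call a cut S of G tight if it has size ℓ, contains v (S v ≡ true)
-- and avoids the chosen neighbours.  Comparing R and S edge by edge, only eᵢ, eⱼ differ, so
--    |δ_G(R)| + c′ = |δ_{G′}(S)| + c with c, c′ of equal parity and c ≤ 2.  Hence
--    |δ_G(R)| is odd, thus ≥ ℓ ≥ |δ_{G′}(S)| + 2, which forces |δ_G(R)| = ℓ and c = 2,
--    i.e. R separates v from vᵢ and vⱼ: a tight cut avoiding vᵢ, vⱼ.
--  * Uncrossing (tight-meet): two tight cuts X, Y that both avoid a neighbour u of v
--    have a tight intersection.  By parity either |δ(X∩Y)| and |δ(X∪Y)| are odd, and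
--    submodularity gives |δ(X∩Y)| = ℓ; or |δ(X∖Y)| and |δ(Y∖X)| are odd, contradicting
--    posimodularity, which is strict by 2 because of the edge vu.
--  * Chaining (chain): intersecting the tight cuts of consecutive pairs one by one
--    gives a single tight cut avoiding all of v₁, …, v_k, which is lemma4.

open import Defs
open import Data.Nat using (ℕ; zero; suc; _+_; _≤_; _<_; _≤?_; z≤n; s≤s; parity)
open import Data.Nat.Properties
  using ( +-assoc; +-comm; +-mono-≤; +-monoˡ-≤; +-monoʳ-≤; +-cancelˡ-≤; +-cancelʳ-≤; +-0-monoid
        ; +-commutativeSemigroup; ≤-refl; ≤-trans; ≤-reflexive; ≤-antisym; ≮⇒≥
        ; m≤m+n; m≤n⇒m<n∨m≡n; m+1+n≰m; 1+n≢n; module ≤-Reasoning)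
open import Data.Parity.Base as ℙ using (0ℙ; 1ℙ)
open import Data.Parity.Properties as ℙₚ using (p≢p⁻¹; suc-homo-⁻¹; +-homo-+; +-cancelʳ-≡)
import Algebra.Properties.CommutativeSemigroup as CommSemigroupProperties
open import Algebra.Properties.Monoid.Sum +-0-monoid using (sum-cong-≗) renaming (sum to ∑)
open import Data.Fin using (Fin; toℕ; inject₁; fromℕ; _≟_) renaming (zero to fzero; suc to fsuc)
open import Data.Fin.Properties using (suc-injective)
open import Data.Bool using (Bool; true; false; T; not; _∧_; _∨_; _xor_; if_then_else_)
open import Data.Bool.Properties using (T-∧; ∧-zeroʳ; xor-comm; not-involutive; not-distribˡ-xor; not-distribʳ-xor)
open import Data.Vec.Functional using ([]; _∷_)
open import Data.List using (map; allFin; tabulate)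
open import Data.List.Properties using (map-tabulate)
open import Data.Nat.ListAction using (sum)
open import Data.Sum using (_⊎_; inj₁; inj₂)
open import Data.Product using (Σ; _×_; _,_; proj₁; proj₂)
open import Data.Empty using (⊥-elim)
open import Function using (_∘_; id; Equivalence)
open import Function.Definitions using (Injective)
open import Relation.Nullary using (Dec; yes; no; contradiction)
open import Relation.Nullary.Decidable using (isYes; toWitness)
open import Relation.Binary.PropositionalEquality using (_≡_; _≢_; refl; sym; trans; cong; cong₂; subst; subst₂; module ≡-Reasoning)

sum-allFin : ∀ {m} (f : Fin m → ℕ) → sum (map f (allFin m)) ≡ ∑ f
sum-allFin f = trans (cong sum (map-tabulate id f)) (sum-tabulate f)
  where
  sum-tabulate : ∀ {n} (g : Fin n → ℕ) → sum (tabulate g) ≡ ∑ g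
  sum-tabulate {zero} g = refl
  sum-tabulate {suc n} g = cong (g fzero +_) (sum-tabulate (g ∘ fsuc))

∑-+ : ∀ {m} (f g : Fin m → ℕ) → ∑ (λ i → f i + g i) ≡ ∑ f + ∑ g
∑-+ {zero} f g = refl
∑-+ {suc m} f g = begin
  (f fzero + g fzero) + ∑ (λ i → f (fsuc i) + g (fsuc i))
    ≡⟨ cong (f fzero + g fzero +_) (∑-+ (f ∘ fsuc) (g ∘ fsuc)) ⟩
  (f fzero + g fzero) + (∑ (f ∘ fsuc) + ∑ (g ∘ fsuc))
    ≡⟨ interchange (f fzero) (g fzero) (∑ (f ∘ fsuc)) (∑ (g ∘ fsuc)) ⟩
  (f fzero + ∑ (f ∘ fsuc)) + (g fzero + ∑ (g ∘ fsuc)) ∎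
  where
  open ≡-Reasoning
  open CommSemigroupProperties +-commutativeSemigroup using (interchange)

∑-mono : ∀ {m} {f g : Fin m → ℕ} → (∀ i → f i ≤ g i) → ∑ f ≤ ∑ g
∑-mono {zero} f≤g = z≤n
∑-mono {suc m} f≤g = +-mono-≤ (f≤g fzero) (∑-mono (f≤g ∘ fsuc))

∑-mono-gap : ∀ {m k} {f g : Fin m → ℕ} (a : Fin m)
           → (∀ i → f i ≤ g i) → f a + k ≤ g a → ∑ f + k ≤ ∑ g
∑-mono-gap {k = k} {f} {g} fzero f≤g gap = begin
  (f fzero + ∑ (f ∘ fsuc)) + k ≡⟨ +-assoc (f fzero) _ k ⟩
  f fzero + (∑ (f ∘ fsuc) + k) ≡⟨ cong (f fzero +_) (+-comm _ k) ⟩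
  f fzero + (k + ∑ (f ∘ fsuc)) ≡⟨ +-assoc (f fzero) k _ ⟨
  (f fzero + k) + ∑ (f ∘ fsuc) ≤⟨ +-mono-≤ gap (∑-mono (f≤g ∘ fsuc)) ⟩
  g fzero + ∑ (g ∘ fsuc)       ∎
  where open ≤-Reasoning
∑-mono-gap {k = k} {f} {g} (fsuc a) f≤g gap = begin
  (f fzero + ∑ (f ∘ fsuc)) + k ≡⟨ +-assoc (f fzero) _ k ⟩
  f fzero + (∑ (f ∘ fsuc) + k) ≤⟨ +-mono-≤ (f≤g fzero) (∑-mono-gap a (f≤g ∘ fsuc) gap) ⟩
  g fzero + ∑ (g ∘ fsuc)       ∎
  where open ≤-Reasoning

∑-update : ∀ {m} {f g : Fin m → ℕ} (a : Fin m)
         → (∀ i → i ≢ a → f i ≡ g i) → ∑ f + g a ≡ ∑ g + f a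
∑-update {f = f} {g} fzero agree = begin
  (f fzero + ∑ (f ∘ fsuc)) + g fzero ≡⟨ +-comm (f fzero + _) (g fzero) ⟩
  g fzero + (f fzero + ∑ (f ∘ fsuc)) ≡⟨ cong (g fzero +_) (+-comm (f fzero) _) ⟩
  g fzero + (∑ (f ∘ fsuc) + f fzero) ≡⟨ +-assoc (g fzero) _ (f fzero) ⟨
  (g fzero + ∑ (f ∘ fsuc)) + f fzero ≡⟨ cong (λ s → g fzero + s + f fzero) tails ⟩
  (g fzero + ∑ (g ∘ fsuc)) + f fzero ∎
  where
  open ≡-Reasoning
  tails : ∑ (f ∘ fsuc) ≡ ∑ (g ∘ fsuc)
  tails = sum-cong-≗ (λ i → agree (fsuc i) (λ ()))
∑-update {f = f} {g} (fsuc a) agree = begin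
  (f fzero + ∑ (f ∘ fsuc)) + g (fsuc a) ≡⟨ +-assoc (f fzero) _ _ ⟩
  f fzero + (∑ (f ∘ fsuc) + g (fsuc a)) ≡⟨ cong₂ _+_ (agree fzero (λ ())) (∑-update a (λ i i≢a → agree (fsuc i) (i≢a ∘ suc-injective))) ⟩
  g fzero + (∑ (g ∘ fsuc) + f (fsuc a)) ≡⟨ +-assoc (g fzero) _ _ ⟨
  (g fzero + ∑ (g ∘ fsuc)) + f (fsuc a) ∎
  where open ≡-Reasoning

∑-update₂ : ∀ {m} {f g : Fin m → ℕ} (a b : Fin m) → a ≢ b
          → (∀ i → i ≢ a → i ≢ b → f i ≡ g i) → ∑ f + (g a + g b) ≡ ∑ g + (f a + f b)
∑-update₂ fzero fzero a≢b _ = contradiction refl a≢b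
∑-update₂ {f = f} {g} fzero (fsuc b) a≢b agree = begin
  (f fzero + ∑ (f ∘ fsuc)) + (g fzero + g (fsuc b)) ≡⟨ interchange (f fzero) _ (g fzero) _ ⟩
  (f fzero + g fzero) + (∑ (f ∘ fsuc) + g (fsuc b)) ≡⟨ cong₂ _+_ (+-comm (f fzero) _) tails ⟩
  (g fzero + f fzero) + (∑ (g ∘ fsuc) + f (fsuc b)) ≡⟨ interchange (g fzero) _ (∑ (g ∘ fsuc)) _ ⟩
  (g fzero + ∑ (g ∘ fsuc)) + (f fzero + f (fsuc b)) ∎
  where
  open ≡-Reasoning
  open CommSemigroupProperties +-commutativeSemigroup using (interchange)
  tails : ∑ (f ∘ fsuc) + g (fsuc b) ≡ ∑ (g ∘ fsuc) + f (fsuc b)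
  tails = ∑-update b (λ i i≢b → agree (fsuc i) (λ ()) (i≢b ∘ suc-injective))
∑-update₂ {f = f} {g} (fsuc a) fzero a≢b agree = begin
  ∑ f + (g (fsuc a) + g fzero) ≡⟨ cong (∑ f +_) (+-comm (g (fsuc a)) _) ⟩
  ∑ f + (g fzero + g (fsuc a)) ≡⟨ ∑-update₂ fzero (fsuc a) (a≢b ∘ sym) (λ i i≢b i≢a → agree i i≢a i≢b) ⟩
  ∑ g + (f fzero + f (fsuc a)) ≡⟨ cong (∑ g +_) (+-comm (f fzero) _) ⟩
  ∑ g + (f (fsuc a) + f fzero) ∎
  where open ≡-Reasoning
∑-update₂ {f = f} {g} (fsuc a) (fsuc b) a≢b agree = begin
  (f fzero + ∑ (f ∘ fsuc)) + (g (fsuc a) + g (fsuc b)) ≡⟨ +-assoc (f fzero) _ _ ⟩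
  f fzero + (∑ (f ∘ fsuc) + (g (fsuc a) + g (fsuc b))) ≡⟨ cong₂ _+_ (agree fzero (λ ()) (λ ())) tails ⟩
  g fzero + (∑ (g ∘ fsuc) + (f (fsuc a) + f (fsuc b))) ≡⟨ +-assoc (g fzero) _ _ ⟨
  (g fzero + ∑ (g ∘ fsuc)) + (f (fsuc a) + f (fsuc b)) ∎
  where
  open ≡-Reasoning
  tails : ∑ (f ∘ fsuc) + (g (fsuc a) + g (fsuc b)) ≡ ∑ (g ∘ fsuc) + (f (fsuc a) + f (fsuc b))
  tails = ∑-update₂ a b (a≢b ∘ cong fsuc)
            (λ i i≢a i≢b → agree (fsuc i) (i≢a ∘ suc-injective) (i≢b ∘ suc-injective))

odd⇒parity : ∀ n → Odd n → parity n ≡ 1ℙ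
odd⇒parity (suc zero) _ = refl
odd⇒parity (suc (suc n)) odd = odd⇒parity n odd

parity⇒odd : ∀ n → parity n ≡ 1ℙ → Odd n
parity⇒odd (suc zero) _ = refl
parity⇒odd (suc (suc n)) odd = parity⇒odd n odd

odd⇒parity′ : ∀ {m n} → m ≡ n → Odd n → parity m ≡ 1ℙ
odd⇒parity′ {n = n} refl = odd⇒parity n

parity-gap : ∀ {s ℓ} → parity s ≡ parity ℓ → s < ℓ → suc (suc s) ≤ ℓ
parity-gap {s} same s<ℓ with m≤n⇒m<n∨m≡n s<ℓ
... | inj₁ s+1<ℓ = s+1<ℓ
... | inj₂ refl = ⊥-elim (p≢p⁻¹ (parity (suc s)) (trans (sym same) (sym (suc-homo-⁻¹ s))))

odd-split : ∀ f p q → f ℙ.+ p ≡ 1ℙ → f ℙ.+ q ≡ 1ℙ → (f ≡ 1ℙ × p ≡ 0ℙ) ⊎ (p ≡ 1ℙ × q ≡ 1ℙ)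
odd-split 1ℙ 0ℙ q _ _ = inj₁ (refl , refl)
odd-split 0ℙ 1ℙ 1ℙ _ _ = inj₂ (refl , refl)
odd-split 0ℙ 1ℙ 0ℙ _ ()
odd-split 1ℙ 1ℙ q () _
odd-split 0ℙ 0ℙ q () _

-- If a + c′ = s + c with c ≤ 2 and s + 2 ≤ ℓ ≤ a, then the chain
-- a ≤ a + c′ = s + c ≤ s + 2 ≤ ℓ ≤ a is tight: a = ℓ and c = 2.
squeeze : ∀ {a c′ s c ℓ} → a + c′ ≡ s + c → c ≤ 2 → suc (suc s) ≤ ℓ → ℓ ≤ a → a ≡ ℓ × c ≡ 2
squeeze {a} {c′} {s} {c} {ℓ} balance c≤2 gap ℓ≤a = ≤-antisym a≤ℓ ℓ≤a , ≤-antisym c≤2 2≤c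
  where
  a≤s+c : a ≤ s + c
  a≤s+c = ≤-trans (m≤m+n a c′) (≤-reflexive balance)
  a≤ℓ : a ≤ ℓ
  a≤ℓ = ≤-trans a≤s+c (≤-trans (+-monoʳ-≤ s c≤2) (subst (_≤ ℓ) (+-comm 2 s) gap))
  2≤c : 2 ≤ c
  2≤c = +-cancelˡ-≤ s 2 c (subst (_≤ s + c) (+-comm 2 s) (≤-trans gap (≤-trans ℓ≤a a≤s+c)))

parity-∑ : ∀ {m} (h f g : Fin m → ℕ) → (∀ i → parity (h i) ≡ parity (f i) ℙ.+ parity (g i))
         → parity (∑ h) ≡ parity (∑ f) ℙ.+ parity (∑ g)
parity-∑ {zero} h f g pointwise = refl
parity-∑ {suc m} h f g pointwise = begin
  parity (h fzero + ∑ (h ∘ fsuc))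
    ≡⟨ +-homo-+ (h fzero) _ ⟩
  parity (h fzero) ℙ.+ parity (∑ (h ∘ fsuc))
    ≡⟨ cong₂ ℙ._+_ (pointwise fzero) (parity-∑ (h ∘ fsuc) (f ∘ fsuc) (g ∘ fsuc) (pointwise ∘ fsuc)) ⟩
  (parity (f fzero) ℙ.+ parity (g fzero)) ℙ.+ (parity (∑ (f ∘ fsuc)) ℙ.+ parity (∑ (g ∘ fsuc)))
    ≡⟨ interchange (parity (f fzero)) _ _ _ ⟩
  (parity (f fzero) ℙ.+ parity (∑ (f ∘ fsuc))) ℙ.+ (parity (g fzero) ℙ.+ parity (∑ (g ∘ fsuc)))
    ≡⟨ cong₂ ℙ._+_ (+-homo-+ (f fzero) _) (+-homo-+ (g fzero) _) ⟨
  parity (f fzero + ∑ (f ∘ fsuc)) ℙ.+ parity (g fzero + ∑ (g ∘ fsuc)) ∎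
  where
  open ≡-Reasoning
  open CommSemigroupProperties ℙₚ.+-commutativeSemigroup using (interchange)

all𝔹 : (Bool → Bool) → Bool
all𝔹 p = p true ∧ p false

all𝔹-sound : (p : Bool → Bool) → T (all𝔹 p) → ∀ b → T (p b)
all𝔹-sound p ok true = proj₁ (Equivalence.to T-∧ ok)
all𝔹-sound p ok false = proj₂ (Equivalence.to T-∧ ok)

-- A decidable property of four Booleans holds everywhere if it holds at all 16 points;
-- the premise is then the trivially true type ⊤ and can be left to Agda.
decide⁴ : {P : Bool → Bool → Bool → Bool → Set} (P? : ∀ a b c d → Dec (P a b c d))
        → T (all𝔹 λ a → all𝔹 λ b → all𝔹 λ c → all𝔹 λ d → isYes (P? a b c d))
        → ∀ a b c d → P a b c d
decide⁴ P? ok a b c d = toWitness {a? = P? a b c d}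
  (all𝔹-sound (λ d → isYes (P? a b c d))
    (all𝔹-sound (λ c → all𝔹 λ d → isYes (P? a b c d))
      (all𝔹-sound (λ b → all𝔹 λ c → all𝔹 λ d → isYes (P? a b c d))
        (all𝔹-sound (λ a → all𝔹 λ b → all𝔹 λ c → all𝔹 λ d → isYes (P? a b c d)) ok a) b) c) d)

src tgt : (G : Graph) → Fin (nE G) → Fin (nV G)
src G e = proj₁ (ends G e)
tgt G e = proj₂ (ends G e)

bit : Bool → ℕ
bit b = if b then 1 else 0

bit≤1 : ∀ b → bit b ≤ 1
bit≤1 true = ≤-refl
bit≤1 false = z≤n

bits-full : ∀ b₁ b₂ → bit b₁ + bit b₂ ≡ 2 → b₁ ≡ true × b₂ ≡ true
bits-full true true _ = refl , refl
bits-full true false ()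
bits-full false true ()
bits-full false false ()

crossing : (G : Graph) → (Fin (nV G) → Bool) → Fin (nE G) → ℕ
crossing G S e = bit (S (src G e) xor S (tgt G e))

cut-∑ : ∀ G S → cutSize G S ≡ ∑ (crossing G S)
cut-∑ G S = sum-allFin (crossing G S)

cut-+ : ∀ G S S′ → cutSize G S + cutSize G S′ ≡ ∑ (λ e → crossing G S e + crossing G S′ e)
cut-+ G S S′ = trans (cong₂ _+_ (cut-∑ G S) (cut-∑ G S′)) (sym (∑-+ (crossing G S) (crossing G S′)))

crossing-joins : ∀ G e {v u} (S : Fin (nV G) → Bool) → Joins G e v u → crossing G S e ≡ bit (S v xor S u)
crossing-joins G e S (inj₁ ends≡vu) = cong (λ p → bit (S (proj₁ p) xor S (proj₂ p))) ends≡vu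
crossing-joins G e {v} {u} S (inj₂ ends≡uv) =
  trans (cong (λ p → bit (S (proj₁ p) xor S (proj₂ p))) ends≡uv) (cong bit (xor-comm (S u) (S v)))

cut-complement : ∀ G S → cutSize G (not ∘ S) ≡ cutSize G S
cut-complement G S = begin
  cutSize G (not ∘ S)   ≡⟨ cut-∑ G (not ∘ S) ⟩
  ∑ (crossing G (not ∘ S)) ≡⟨ sum-cong-≗ (λ e → cong bit (not-xor-not (S (src G e)) (S (tgt G e)))) ⟩
  ∑ (crossing G S)      ≡⟨ cut-∑ G S ⟨
  cutSize G S           ∎
  where
  open ≡-Reasoning
  not-xor-not : ∀ a b → not a xor not b ≡ a xor b
  not-xor-not a b = begin
    not a xor not b     ≡⟨ not-distribˡ-xor a (not b) ⟨
    not (a xor not b)   ≡⟨ cong not (not-distribʳ-xor a b) ⟨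
    not (not (a xor b)) ≡⟨ not-involutive (a xor b) ⟩
    a xor b             ∎

cut-parity : ∀ G S S₁ S₂
           → (∀ e → parity (crossing G S e) ≡ parity (crossing G S₁ e) ℙ.+ parity (crossing G S₂ e))
           → parity (cutSize G S) ≡ parity (cutSize G S₁) ℙ.+ parity (cutSize G S₂)
cut-parity G S S₁ S₂ pointwise = begin
  parity (cutSize G S)                                  ≡⟨ cong parity (cut-∑ G S) ⟩
  parity (∑ (crossing G S))                             ≡⟨ parity-∑ _ _ _ pointwise ⟩
  parity (∑ (crossing G S₁)) ℙ.+ parity (∑ (crossing G S₂))
    ≡⟨ cong₂ ℙ._+_ (cong parity (cut-∑ G S₁)) (cong parity (cut-∑ G S₂)) ⟨
  parity (cutSize G S₁) ℙ.+ parity (cutSize G S₂)       ∎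
  where open ≡-Reasoning

oddCut-large : ∀ {ℓ} G → OddConnected ℓ G → ∀ S → parity (cutSize G S) ≡ 1ℙ → ℓ ≤ cutSize G S
oddCut-large G conn S odd = ≮⇒≥ (λ small → conn (S , parity⇒odd (cutSize G S) odd , small))

_∩_ _∪_ _∖_ : {A : Set} → (A → Bool) → (A → Bool) → A → Bool
(X ∩ Y) z = X z ∧ Y z
(X ∪ Y) z = X z ∨ Y z
(X ∖ Y) z = X z ∧ not (Y z)

module Uncrossing (G : Graph) (X Y : Fin (nV G) → Bool) where

  atEnds : {P : Bool → Bool → Bool → Bool → Set} → (∀ xa ya xb yb → P xa ya xb yb)
         → ∀ e → P (X (src G e)) (Y (src G e)) (X (tgt G e)) (Y (tgt G e))
  atEnds fact e = fact (X (src G e)) (Y (src G e)) (X (tgt G e)) (Y (tgt G e))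

  cut-submodular : cutSize G (X ∩ Y) + cutSize G (X ∪ Y) ≤ cutSize G X + cutSize G Y
  cut-submodular = begin
    cutSize G (X ∩ Y) + cutSize G (X ∪ Y)               ≡⟨ cut-+ G (X ∩ Y) (X ∪ Y) ⟩
    ∑ (λ e → crossing G (X ∩ Y) e + crossing G (X ∪ Y) e) ≤⟨ ∑-mono (atEnds edgewise) ⟩
    ∑ (λ e → crossing G X e + crossing G Y e)             ≡⟨ cut-+ G X Y ⟨
    cutSize G X + cutSize G Y                           ∎
    where
    open ≤-Reasoning
    edgewise : ∀ xa ya xb yb
             → bit ((xa ∧ ya) xor (xb ∧ yb)) + bit ((xa ∨ ya) xor (xb ∨ yb)) ≤ bit (xa xor xb) + bit (ya xor yb)
    edgewise = decide⁴ (λ xa ya xb yb → _ ≤? _) _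

  cut-posimodular : ∀ {e v u} → Joins G e v u → X v ≡ true → Y v ≡ true → X u ≡ false → Y u ≡ false
                  → cutSize G (X ∖ Y) + cutSize G (Y ∖ X) + 2 ≤ cutSize G X + cutSize G Y
  cut-posimodular {e} {v} {u} vu Xv Yv Xu Yu = begin
    cutSize G (X ∖ Y) + cutSize G (Y ∖ X) + 2
      ≡⟨ cong (_+ 2) (cut-+ G (X ∖ Y) (Y ∖ X)) ⟩
    ∑ (λ e → crossing G (X ∖ Y) e + crossing G (Y ∖ X) e) + 2
      ≤⟨ ∑-mono-gap e (atEnds edgewise) at-vu ⟩
    ∑ (λ e → crossing G X e + crossing G Y e)
      ≡⟨ cut-+ G X Y ⟨
    cutSize G X + cutSize G Y ∎
    where
    open ≤-Reasoning
    edgewise : ∀ xa ya xb yb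
             → bit ((xa ∧ not ya) xor (xb ∧ not yb)) + bit ((ya ∧ not xa) xor (yb ∧ not xb))
               ≤ bit (xa xor xb) + bit (ya xor yb)
    edgewise = decide⁴ (λ xa ya xb yb → _ ≤? _) _
    at-vu : crossing G (X ∖ Y) e + crossing G (Y ∖ X) e + 2 ≤ crossing G X e + crossing G Y e
    at-vu = subst₂ (λ l r → l + 2 ≤ r)
              (sym (cong₂ _+_ (cross-vu (X ∖ Y)) (cross-vu (Y ∖ X))))
              (sym (cong₂ _+_ (cross-vu X) (cross-vu Y)))
              values
      where
      cross-vu : ∀ S → crossing G S e ≡ bit (S v xor S u)
      cross-vu S = crossing-joins G e S vu
      values : bit ((X v ∧ not (Y v)) xor (X u ∧ not (Y u))) + bit ((Y v ∧ not (X v)) xor (Y u ∧ not (X u))) + 2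
               ≤ bit (X v xor X u) + bit (Y v xor Y u)
      values rewrite Xv | Yv | Xu | Yu = ≤-refl

  parity-X : parity (cutSize G X) ≡ parity (cutSize G (X ∩ Y)) ℙ.+ parity (cutSize G (X ∖ Y))
  parity-X = cut-parity G X (X ∩ Y) (X ∖ Y) (atEnds edgewise)
    where
    edgewise : ∀ xa ya xb yb → parity (bit (xa xor xb))
               ≡ parity (bit ((xa ∧ ya) xor (xb ∧ yb))) ℙ.+ parity (bit ((xa ∧ not ya) xor (xb ∧ not yb)))
    edgewise = decide⁴ (λ xa ya xb yb → _ ℙₚ.≟ _) _

  parity-Y : parity (cutSize G Y) ≡ parity (cutSize G (X ∩ Y)) ℙ.+ parity (cutSize G (Y ∖ X))
  parity-Y = cut-parity G Y (X ∩ Y) (Y ∖ X) (atEnds edgewise)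
    where
    edgewise : ∀ xa ya xb yb → parity (bit (ya xor yb))
               ≡ parity (bit ((xa ∧ ya) xor (xb ∧ yb))) ℙ.+ parity (bit ((ya ∧ not xa) xor (yb ∧ not xb)))
    edgewise = decide⁴ (λ xa ya xb yb → _ ℙₚ.≟ _) _

  parity-∪ : parity (cutSize G (X ∪ Y)) ≡ parity (cutSize G Y) ℙ.+ parity (cutSize G (X ∖ Y))
  parity-∪ = cut-parity G (X ∪ Y) Y (X ∖ Y) (atEnds edgewise)
    where
    edgewise : ∀ xa ya xb yb → parity (bit ((xa ∨ ya) xor (xb ∨ yb)))
               ≡ parity (bit (ya xor yb)) ℙ.+ parity (bit ((xa ∧ not ya) xor (xb ∧ not yb)))
    edgewise = decide⁴ (λ xa ya xb yb → _ ℙₚ.≟ _) _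

  tight-meet : ∀ {ℓ e v u} → Odd ℓ → OddConnected ℓ G → cutSize G X ≡ ℓ → cutSize G Y ≡ ℓ
             → Joins G e v u → X v ≡ true → Y v ≡ true → X u ≡ false → Y u ≡ false
             → cutSize G (X ∩ Y) ≡ ℓ
  tight-meet {ℓ} oddℓ conn |X|≡ℓ |Y|≡ℓ vu Xv Yv Xu Yu
    with odd-split _ _ _ (trans (sym parity-X) (odd⇒parity′ |X|≡ℓ oddℓ)) (trans (sym parity-Y) (odd⇒parity′ |Y|≡ℓ oddℓ))
  ... | inj₁ (∩-odd , X∖Y-even) = ≤-antisym upper (oddCut-large G conn (X ∩ Y) ∩-odd)
    where
    ∪-odd : parity (cutSize G (X ∪ Y)) ≡ 1ℙ
    ∪-odd = trans parity-∪ (cong₂ ℙ._+_ (odd⇒parity′ |Y|≡ℓ oddℓ) X∖Y-even)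
    upper : cutSize G (X ∩ Y) ≤ ℓ
    upper = +-cancelʳ-≤ ℓ _ ℓ (begin
      cutSize G (X ∩ Y) + ℓ                 ≤⟨ +-monoʳ-≤ _ (oddCut-large G conn (X ∪ Y) ∪-odd) ⟩
      cutSize G (X ∩ Y) + cutSize G (X ∪ Y) ≤⟨ cut-submodular ⟩
      cutSize G X + cutSize G Y             ≡⟨ cong₂ _+_ |X|≡ℓ |Y|≡ℓ ⟩
      ℓ + ℓ                                 ∎)
      where open ≤-Reasoning
  ... | inj₂ (X∖Y-odd , Y∖X-odd) = contradiction too-large (m+1+n≰m (ℓ + ℓ))
    where
    too-large : ℓ + ℓ + 2 ≤ ℓ + ℓ
    too-large = begin
      ℓ + ℓ + 2
        ≤⟨ +-monoˡ-≤ 2 (+-mono-≤ (oddCut-large G conn (X ∖ Y) X∖Y-odd) (oddCut-large G conn (Y ∖ X) Y∖X-odd)) ⟩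
      cutSize G (X ∖ Y) + cutSize G (Y ∖ X) + 2 ≤⟨ cut-posimodular vu Xv Yv Xu Yu ⟩
      cutSize G X + cutSize G Y                 ≡⟨ cong₂ _+_ |X|≡ℓ |Y|≡ℓ ⟩
      ℓ + ℓ                                     ∎
      where open ≤-Reasoning

record TightCut (ℓ : ℕ) (G : Graph) (v : Fin (nV G)) {n : ℕ} (u : Fin n → Fin (nV G)) : Set where
  constructor tight
  field
    side     : Fin (nV G) → Bool
    has-v    : side v ≡ true
    avoids-u : ∀ i → side (u i) ≡ false
    size     : cutSize G side ≡ ℓ

orient : ∀ {ℓ G v n} {u : Fin n → Fin (nV G)} (S : Fin (nV G) → Bool)
       → cutSize G S ≡ ℓ → (∀ i → S v xor S (u i) ≡ true) → TightCut ℓ G v u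
orient {G = G} {v = v} {u = u} S |S|≡ℓ separates with S v in Sv
... | true  = tight S Sv (λ i → true-side (separates i)) |S|≡ℓ
  where
  true-side : ∀ {b} → true xor b ≡ true → b ≡ false
  true-side {false} _ = refl
  true-side {true} ()
... | false = tight (not ∘ S) (cong not Sv) (λ i → false-side (separates i)) (trans (cut-complement G S) |S|≡ℓ)
  where
  false-side : ∀ {b} → false xor b ≡ true → not b ≡ false
  false-side refl = refl

module Splitting (G : Graph) (v : Fin (nV G)) (e₁ : Fin (nE G)) (v₁ : Fin (nV G))
                 (e₂ : Fin (nE G)) (v₂ : Fin (nV G)) where

  G′ : Graph
  G′ = split G v e₁ v₁ e₂ v₂

  new : Fin (nV G′)
  new = fromℕ (nV G)

  ends-e₁ : ends G′ e₁ ≡ (inject₁ v₁ , new)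
  ends-e₁ with e₁ ≟ e₁
  ... | yes _ = refl
  ... | no e₁≢e₁ = contradiction refl e₁≢e₁

  ends-e₂ : e₁ ≢ e₂ → ends G′ e₂ ≡ (inject₁ v₂ , new)
  ends-e₂ e₁≢e₂ with e₂ ≟ e₁
  ... | yes e₂≡e₁ = contradiction (sym e₂≡e₁) e₁≢e₂
  ... | no _ with e₂ ≟ e₂
  ...   | yes _ = refl
  ...   | no e₂≢e₂ = contradiction refl e₂≢e₂

  ends-other : ∀ e → e ≢ e₁ → e ≢ e₂ → ends G′ e ≡ (inject₁ (src G e) , inject₁ (tgt G e))
  ends-other e e≢e₁ e≢e₂ with e ≟ e₁
  ... | yes e≡e₁ = contradiction e≡e₁ e≢e₁
  ... | no _ with e ≟ e₂
  ...   | yes e≡e₂ = contradiction e≡e₂ e≢e₂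
  ...   | no _ = refl

  split-cut : e₁ ≢ e₂ → Joins G e₁ v v₁ → Joins G e₂ v v₂ → (S : Fin (nV G′) → Bool)
            → let R = S ∘ inject₁ in
              cutSize G R + (bit (R v₁ xor S new) + bit (R v₂ xor S new))
              ≡ cutSize G′ S + (bit (R v xor R v₁) + bit (R v xor R v₂))
  split-cut e₁≢e₂ vv₁ vv₂ S = begin
    cutSize G R + (bit (R v₁ xor S new) + bit (R v₂ xor S new))
      ≡⟨ cong₂ _+_ (cut-∑ G R) (sym (cong₂ _+_ (crossing-joins G′ e₁ S (inj₁ ends-e₁)) (crossing-joins G′ e₂ S (inj₁ (ends-e₂ e₁≢e₂))))) ⟩
    ∑ (crossing G R) + (crossing G′ S e₁ + crossing G′ S e₂)
      ≡⟨ ∑-update₂ e₁ e₂ e₁≢e₂ (λ e e≢e₁ e≢e₂ → sym (crossing-joins G′ e S (inj₁ (ends-other e e≢e₁ e≢e₂)))) ⟩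
    ∑ (crossing G′ S) + (crossing G R e₁ + crossing G R e₂)
      ≡⟨ cong₂ _+_ (sym (cut-∑ G′ S)) (cong₂ _+_ (crossing-joins G e₁ R vv₁) (crossing-joins G e₂ R vv₂)) ⟩
    cutSize G′ S + (bit (R v xor R v₁) + bit (R v xor R v₂)) ∎
    where
    open ≡-Reasoning
    R : Fin (nV G) → Bool
    R = S ∘ inject₁

  split-pair : ∀ {ℓ} → Odd ℓ → OddConnected ℓ G → e₁ ≢ e₂ → Joins G e₁ v v₁ → Joins G e₂ v v₂
             → HasSmallOddCut ℓ G′ → TightCut ℓ G v (v₁ ∷ v₂ ∷ [])
  split-pair {ℓ} oddℓ conn e₁≢e₂ vv₁ vv₂ (S , S-odd , S-small) = orient R |R|≡ℓ separates
    where
    R : Fin (nV G) → Bool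
    R = S ∘ inject₁
    c′ c : ℕ
    c′ = bit (R v₁ xor S new) + bit (R v₂ xor S new)
    c = bit (R v xor R v₁) + bit (R v xor R v₂)
    balance : cutSize G R + c′ ≡ cutSize G′ S + c
    balance = split-cut e₁≢e₂ vv₁ vv₂ S
    -- both c and c′ are congruent to [R v₁ ≠ R v₂] modulo 2
    c′≡c : parity c′ ≡ parity c
    c′≡c = decide⁴ {λ a b₁ b₂ x → parity (bit (b₁ xor x) + bit (b₂ xor x)) ≡ parity (bit (a xor b₁) + bit (a xor b₂))}
                   (λ _ _ _ _ → _ ℙₚ.≟ _) _ (R v) (R v₁) (R v₂) (S new)
    R-odd : parity (cutSize G R) ≡ 1ℙ
    R-odd = +-cancelʳ-≡ (parity c) _ _ (begin
      parity (cutSize G R) ℙ.+ parity c   ≡⟨ cong (parity (cutSize G R) ℙ.+_) c′≡c ⟨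
      parity (cutSize G R) ℙ.+ parity c′  ≡⟨ +-homo-+ (cutSize G R) c′ ⟨
      parity (cutSize G R + c′)           ≡⟨ cong parity balance ⟩
      parity (cutSize G′ S + c)           ≡⟨ +-homo-+ (cutSize G′ S) c ⟩
      parity (cutSize G′ S) ℙ.+ parity c  ≡⟨ cong (ℙ._+ parity c) (odd⇒parity (cutSize G′ S) S-odd) ⟩
      1ℙ ℙ.+ parity c                     ∎)
      where open ≡-Reasoning
    tight-and-full : cutSize G R ≡ ℓ × c ≡ 2
    tight-and-full = squeeze balance (+-mono-≤ (bit≤1 (R v xor R v₁)) (bit≤1 (R v xor R v₂)))
                       (parity-gap (trans (odd⇒parity (cutSize G′ S) S-odd) (sym (odd⇒parity ℓ oddℓ))) S-small)
                       (oddCut-large G conn R R-odd)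
    |R|≡ℓ : cutSize G R ≡ ℓ
    |R|≡ℓ = proj₁ tight-and-full
    separates : ∀ i → R v xor R ((v₁ ∷ v₂ ∷ []) i) ≡ true
    separates fzero = proj₁ (bits-full (R v xor R v₁) (R v xor R v₂) (proj₂ tight-and-full))
    separates (fsuc fzero) = proj₂ (bits-full (R v xor R v₁) (R v xor R v₂) (proj₂ tight-and-full))

module _ {ℓ : ℕ} (oddℓ : Odd ℓ) {G : Graph} (conn : OddConnected ℓ G) (v : Fin (nV G)) where

  -- If every consecutive pair wᵢ, wᵢ₊₁ of neighbours of v is avoided by a tight cut,
  -- then a single tight cut avoids all of them: intersect the cut for w₁, w₂, … with
  -- the cut for w₀, w₁, uncrossing at their common neighbour w₁.
  chain : ∀ n (w : Fin (suc (suc n)) → Fin (nV G)) (e : Fin (suc (suc n)) → Fin (nE G))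
        → (∀ i → Joins G (e i) v (w i))
        → (∀ i j → toℕ j ≡ suc (toℕ i) → TightCut ℓ G v (w i ∷ w j ∷ []))
        → TightCut ℓ G v w
  chain zero w _ _ pairCut = tight side has-v avoids size
    where
    open TightCut (pairCut fzero (fsuc fzero) refl)
    avoids : ∀ i → side (w i) ≡ false
    avoids fzero = avoids-u fzero
    avoids (fsuc fzero) = avoids-u (fsuc fzero)
  chain (suc n) w e joins pairCut =
    tight (side X ∩ side Y) (cong₂ _∧_ (has-v X) (has-v Y)) avoids
      (Uncrossing.tight-meet G (side X) (side Y) oddℓ conn (size X) (size Y)
        (joins (fsuc fzero)) (has-v X) (has-v Y) (avoids-u X fzero) (avoids-u Y (fsuc fzero)))
    where
    open TightCut
    X : TightCut ℓ G v (w ∘ fsuc)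
    X = chain n (w ∘ fsuc) (e ∘ fsuc) (joins ∘ fsuc) (λ i j next → pairCut (fsuc i) (fsuc j) (cong suc next))
    Y : TightCut ℓ G v (w fzero ∷ w (fsuc fzero) ∷ [])
    Y = pairCut fzero (fsuc fzero) refl
    avoids : ∀ i → (side X ∩ side Y) (w i) ≡ false
    avoids fzero = trans (cong (side X (w fzero) ∧_) (avoids-u Y fzero)) (∧-zeroʳ (side X (w fzero)))
    avoids (fsuc i) = cong (_∧ side Y (w (fsuc i))) (avoids-u X i)

lemma4 : (ℓ : ℕ) → 3 ≤ ℓ → Odd ℓ → (G : Graph) → OddConnected ℓ G
    → (v : Fin (nV G)) → (k : ℕ) → 2 ≤ k
    → (w : Fin k → Fin (nV G)) → (e : Fin k → Fin (nE G))
    → Injective _≡_ _≡_ e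
    → (∀ i → Joins G (e i) v (w i))
    → (∀ (i j : Fin k) → toℕ j ≡ suc (toℕ i)
         → HasSmallOddCut ℓ (split G v (e i) (w i) (e j) (w j)))
    → Σ (Fin (nV G) → Bool) λ S →
        (S v ≡ true) × (∀ i → S (w i) ≡ false) × (cutSize G S ≡ ℓ)
lemma4 ℓ _ oddℓ G conn v (suc (suc n)) (s≤s (s≤s _)) w e e-injective joins small =
  side , has-v , avoids-u , size
  where
  pairCut : ∀ i j → toℕ j ≡ suc (toℕ i) → TightCut ℓ G v (w i ∷ w j ∷ [])
  pairCut i j next =
    Splitting.split-pair G v (e i) (w i) (e j) (w j) oddℓ conn (i≢j ∘ e-injective) (joins i) (joins j) (small i j next)
    where
    i≢j : i ≢ j
    i≢j i≡j = 1+n≢n (sym (trans (cong toℕ i≡j) next))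
  open TightCut (chain oddℓ conn v n w e joins pairCut)
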